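{- Let $G=(V,E)$ and $G'=(V',E')$ be digraphs with totally ordered vertex sets, and suppose there is an order-preserving embedding of $G$ into $G'$. If $G$ is not representable, then $G'$ is not representable.
   Context: For pairs $\{a,b\},\{c,d\}$ of positions: they touch if $|\{a,b\}\cap\{c,d\}|=1$; they cross if $\min(a,b)<\min(c,d)<\max(a,b)<\max(c,d)$ or $\min(c,d)<\min(a,b)<\max(c,d)<\max(a,b)$. A secondary structure for an RNA sequence $a_1,\ldots,a_m$ is a set of pairs $(i,j)$, $i<j$, with $a_ia_j\in\{GC,CG,AU,UA,GU,UG\}$, no position in two pairs, no two crossing pairs, and $j-i>3$. Triples of integers $(x,y,z)$ are ordered by $(x,y,z)\prec(x',y',z')$ iff $y<y'$, or $y=y'$ and $x<x'$, or $y=y'$, $x=x'$ and $z<z'$. For a triple $v=(x,y,z)$ write $v.t=\{x,y\}$ and $v.s=\{y,z\}$. A digraph $G=(V,E)$ with $V=\{1,\ldots,n\}$ (ordered as integers) is representable if there exist secondary structures $s,t$ of some RNA sequence and a map $\Phi$ from $V$ to triples such that: (1) for $u,v\in V$, $u<v$ iff $\Phi(u)\prec\Phi(v)$; (2) each $\Phi(v)=(x,y,z)$ has $x,y,z$ distinct with $\{x,y\}\in t$ and $\{y,z\}\in s$; (3) for distinct $u,v\in V$, $(u,v)\in E$ iff $\Phi(u).s$ touches or crosses $\Phi(v).t$. (A digraph with an arbitrary totally ordered finite vertex set is representable if it is so after relabelling its vertices $1,\ldots,n$ in order.) An order-preserving embedding of $G=(V,E,\preceq)$ into $G'=(V',E',\preceq')$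 is an injective $\Phi:V\to V'$ with $u\preceq v$ iff $\Phi(u)\preceq'\Phi(v)$, and $(u,v)\in E$ iff $(\Phi(u),\Phi(v))\in E'$. -}

module Defs where

open import Level using (0ℓ) renaming (suc to lsuc)
open import Data.Nat using (ℕ; _<_; _≤_; _+_; _⊔_; _⊓_)
open import Data.Fin using (Fin; toℕ)
open import Data.Vec using (Vec; lookup)
open import Data.Product using (Σ; _×_; _,_; ∃-syntax)
open import Data.Sum using (_⊎_)
open import Relation.Nullary using (¬_)
open import Relation.Binary.PropositionalEquality using (_≡_; _≢_)

_⟺_ : Set → Set → Set
A ⟺ B = (A → B) × (B → A)

data Base : Set where
  A C G U : Base

data CanPair : Base → Base → Set where
  GC : CanPair G C
  CG : CanPair C G
  AU : CanPair A U
  UA : CanPair U A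
  GU : CanPair G U
  UG : CanPair U G

Meet : ℕ → ℕ → ℕ → ℕ → Set
Meet a b c d = (a ≡ c ⊎ a ≡ d) ⊎ (b ≡ c ⊎ b ≡ d)

SameSet : ℕ → ℕ → ℕ → ℕ → Set
SameSet a b c d = (a ≡ c × b ≡ d) ⊎ (a ≡ d × b ≡ c)

-- touch: |{a,b} ∩ {c,d}| = 1  (nonempty intersection, sets not equal)
Touch : ℕ → ℕ → ℕ → ℕ → Set
Touch a b c d = Meet a b c d × ¬ SameSet a b c d

Cross : ℕ → ℕ → ℕ → ℕ → Set
Cross a b c d =
    ((a ⊓ b) < (c ⊓ d) × (c ⊓ d) < (a ⊔ b) × (a ⊔ b) < (c ⊔ d))
  ⊎ ((c ⊓ d) < (a ⊓ b) × (a ⊓ b) < (c ⊔ d) × (c ⊔ d) < (a ⊔ b))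

record SecStr {m : ℕ} (seq : Vec Base m) : Set₁ where
  field
    pair     : Fin m → Fin m → Set
    ordered  : ∀ {i j} → pair i j → toℕ i < toℕ j
    canPair  : ∀ {i j} → pair i j → CanPair (lookup seq i) (lookup seq j)
    distance : ∀ {i j} → pair i j → toℕ i + 3 < toℕ j
    disjoint : ∀ {i j k l} → pair i j → pair k l →
               Meet (toℕ i) (toℕ j) (toℕ k) (toℕ l) → i ≡ k × j ≡ l
    noCross  : ∀ {i j k l} → pair i j → pair k l →
               ¬ Cross (toℕ i) (toℕ j) (toℕ k) (toℕ l)

open SecStr public

_∋⟦_,_⟧ : ∀ {m} {seq : Vec Base m} → SecStr seq → Fin m → Fin m → Set
s ∋⟦ x , y ⟧ = pair s x y ⊎ pair s y x

Triple : ℕ → Set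
Triple m = Fin m × Fin m × Fin m

_≺_ : ∀ {m} → Triple m → Triple m → Set
(x , y , z) ≺ (x' , y' , z') =
    toℕ y < toℕ y'
  ⊎ (toℕ y ≡ toℕ y' × toℕ x < toℕ x')
  ⊎ (toℕ y ≡ toℕ y' × toℕ x ≡ toℕ x' × toℕ z < toℕ z')

-- Digraphs with totally ordered vertex set {1,…,n}, represented as Fin n
-- ordered as integers; edge relation E.

Digraph : ℕ → Set₁
Digraph n = Fin n → Fin n → Set

-- v.s = {y,z} touches or crosses u.t = {x',y'}
TouchOrCross : ℕ → ℕ → ℕ → ℕ → Set
TouchOrCross a b c d = Touch a b c d ⊎ Cross a b c d

Representable : ∀ {n} → Digraph n → Set₁
Representable {n} E =
  ∃[ m ] Σ (Vec Base m) λ seq → Σ (SecStr seq) λ s → Σ (SecStr seq) λ t →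
  Σ (Fin n → Triple m) λ Φ →
      (∀ u v → (toℕ u < toℕ v) ⟺ (Φ u ≺ Φ v))
    × (∀ v → let (x , y , z) = Φ v in
         x ≢ y × y ≢ z × x ≢ z × t ∋⟦ x , y ⟧ × s ∋⟦ y , z ⟧)
    × (∀ u v → u ≢ v →
         let (x  , y  , z ) = Φ u
             (x' , y' , z') = Φ v
         in E u v ⟺ TouchOrCross (toℕ y) (toℕ z) (toℕ x') (toℕ y'))

record OrderEmbedding {n n' : ℕ} (E : Digraph n) (E' : Digraph n') : Set where
  field
    map       : Fin n → Fin n'
    injective : ∀ u v → map u ≡ map v → u ≡ v
    order     : ∀ u v → (toℕ u ≤ toℕ v) ⟺ (toℕ (map u) ≤ toℕ (map v))
    edges     : ∀ u v → E u v ⟺ E' (map u) (map v)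

module Submission where

-- A representation of a digraph restricts along an order-preserving
-- embedding: if (s , t , Φ) represents E' and f embeds E into E', then
-- (s , t , Φ ∘ f) represents E.  The theorem
-- is the contrapositive of this restriction lemma.

open import Defs
open import Data.Nat using (ℕ; _<_; _≤_)
open import Data.Nat.Properties using (<⇒≱; ≰⇒>)
open import Data.Fin using (toℕ)
open import Data.Product using (_,_; proj₁; proj₂)
open import Function using (_∘_)
open import Relation.Nullary using (¬_)
open import Relation.Binary.PropositionalEquality using (_≢_)

⟺-trans : {A B C : Set} → A ⟺ B → B ⟺ C → A ⟺ C
⟺-trans (a→b , b→a) (b→c , c→b) = b→c ∘ a→b , b→a ∘ c→b

-- A map on ℕ that preserves and reflects ≤ also preserves and reflects <,
-- since m < n is equivalent to ¬ (n ≤ m).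
strictFromNonStrict : ∀ {a b a' b' : ℕ} →
  (b ≤ a) ⟺ (b' ≤ a') → (a < b) ⟺ (a' < b')
strictFromNonStrict (≤→≤' , ≤'→≤) =
    (λ a<b → ≰⇒> (<⇒≱ a<b ∘ ≤'→≤))
  , (λ a'<b' → ≰⇒> (<⇒≱ a'<b' ∘ ≤→≤'))

module _ {n n' : ℕ} {E : Digraph n} {E' : Digraph n'}
         (emb : OrderEmbedding E E') where
  open OrderEmbedding emb renaming (map to f)

  strictOrder : ∀ u v → (toℕ u < toℕ v) ⟺ (toℕ (f u) < toℕ (f v))
  strictOrder u v = strictFromNonStrict (order v u)

  distinctImages : ∀ {u v} → u ≢ v → f u ≢ f v
  distinctImages u≢v = u≢v ∘ injective _ _

  restrictRepresentation : Representable E' → Representable E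
  restrictRepresentation (m , seq , s , t , Φ , order' , triples , edges') =
    m , seq , s , t , Φ ∘ f , orderOk , triples ∘ f , edgesOk
    where
      orderOk : ∀ u v → (toℕ u < toℕ v) ⟺ (Φ (f u) ≺ Φ (f v))
      orderOk u v = ⟺-trans (strictOrder u v) (order' (f u) (f v))

      edgesOk : ∀ u v → u ≢ v →
        let (x  , y  , z ) = Φ (f u)
            (x' , y' , z') = Φ (f v)
        in E u v ⟺ TouchOrCross (toℕ y) (toℕ z) (toℕ x') (toℕ y')
      edgesOk u v u≢v =
        ⟺-trans (edges u v) (edges' (f u) (f v) (distinctImages u≢v))

theorem4 : ∀ {n n' : ℕ} (E : Digraph n) (E' : Digraph n') →
           OrderEmbedding E E' → ¬ Representable E → ¬ Representable E'
theorem4 E E' emb notRep = notRep ∘ restrictRepresentation emb
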